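{- Let $G$ be a strongly connected compressed directed graph that is not a closed path. Let $fW$ be an omnitig of $G$ where $f$ is a join arc. Let $P$ be a path with $t(P)=h(W)$ ending at a node of $W$, such that the last arc of $P$ is not an arc of $fW$. Then no internal node of $P$ is a node of $W$.
   Context: Graphs are finite directed multigraphs (parallel arcs and self-loops allowed); $t(e)$, $h(e)$ are tail and head of arc $e$; for a walk, $t$ and $h$ denote its first and last node. A walk $(v_0,e_1,\dots,e_\ell,v_\ell)$ has nodes $v_0,\dots,v_\ell$ and internal nodes $v_1,\dots,v_{\ell-1}$; a path is a walk with distinct nodes except $v_\ell=v_0$ allowed. A closed path is a graph consisting of a single cycle. A node is a join node if its in-degree exceeds 1, a split node if its out-degree exceeds 1, biunivocal if neither; an arc $e$ is a join arc if $h(e)$ is a join node, biunivocal if $h(e)$ has in-degree 1 and $t(e)$ out-degree 1. A graph is compressed if it has no biunivocal nodes and no biunivocal arcs. A walk $W=e_0\dots e_\ell$ is an omnitig if for all $1\le i\le j\le \ell$ there is no non-empty path from $t(e_j)$ to $h(e_{i-1})$ whose first arc differs from $e_j$ and whose last arc differs from $e_{i-1}$. -}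

module Defs where

open import Data.Nat using (ℕ; zero; suc; _≤_; _<_; _>_)
open import Data.Fin using (Fin; zero; suc; toℕ; inject₁; fromℕ; _≟_)
open import Data.List using (length; filter; allFin)
open import Data.Product using (Σ; ∃; _×_)
open import Data.Sum using (_⊎_)
open import Data.Empty using (⊥)
open import Relation.Nullary using (¬_)
open import Relation.Binary.PropositionalEquality using (_≡_; _≢_; refl)

record Graph : Set where
  field
    n  : ℕ
    m  : ℕ
    tl : Fin m → Fin n
    hd : Fin m → Fin n

open Graph public

Node : Graph → Set
Node G = Fin (n G)

Arc : Graph → Set
Arc G = Fin (m G)

indeg : (G : Graph) → Node G → ℕ
indeg G v = length (filter (λ e → hd G e ≟ v) (allFin (m G)))

outdeg : (G : Graph) → Node G → ℕ
outdeg G v = length (filter (λ e → tl G e ≟ v) (allFin (m G)))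

IsJoinNode : (G : Graph) → Node G → Set
IsJoinNode G v = indeg G v > 1

IsSplitNode : (G : Graph) → Node G → Set
IsSplitNode G v = outdeg G v > 1

IsBiunivocalNode : (G : Graph) → Node G → Set
IsBiunivocalNode G v = ¬ IsJoinNode G v × ¬ IsSplitNode G v

IsJoinArc : (G : Graph) → Arc G → Set
IsJoinArc G e = IsJoinNode G (hd G e)

IsBiunivocalArc : (G : Graph) → Arc G → Set
IsBiunivocalArc G e = indeg G (hd G e) ≡ 1 × outdeg G (tl G e) ≡ 1

IsCompressed : Graph → Set
IsCompressed G = (∀ v → ¬ IsBiunivocalNode G v) × (∀ e → ¬ IsBiunivocalArc G e)

-- A walk (v_0, e_1, ..., e_ℓ, v_ℓ) of length ℓ: nodes indexed 0..ℓ,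
-- arcs indexed 0..ℓ-1 (arc i goes from node i to node i+1).
record Walk (G : Graph) (ℓ : ℕ) : Set where
  field
    node  : Fin (suc ℓ) → Node G
    arc   : Fin ℓ → Arc G
    tl-ok : ∀ i → tl G (arc i) ≡ node (inject₁ i)
    hd-ok : ∀ i → hd G (arc i) ≡ node (suc i)

open Walk public

start : ∀ {G ℓ} → Walk G ℓ → Node G
start W = node W zero

end : ∀ {G ℓ} → Walk G ℓ → Node G
end {ℓ = ℓ} W = node W (fromℕ ℓ)

IsPath : ∀ {G ℓ} → Walk G ℓ → Set
IsPath {ℓ = ℓ} W = ∀ i j → node W i ≡ node W j →
  i ≡ j ⊎ ((toℕ i ≡ 0 × toℕ j ≡ ℓ) ⊎ (toℕ i ≡ ℓ × toℕ j ≡ 0))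

IsInternalIndex : (ℓ : ℕ) → Fin (suc ℓ) → Set
IsInternalIndex ℓ r = 0 < toℕ r × toℕ r < ℓ

cons : ∀ {G ℓ} (f : Arc G) (W : Walk G ℓ) → hd G f ≡ start W → Walk G (suc ℓ)
cons {G} f W p = record { node = nd ; arc = ar ; tl-ok = tk ; hd-ok = hk }
  where
  nd : Fin _ → Node G
  nd zero = tl G f
  nd (suc i) = node W i
  ar : Fin _ → Arc G
  ar zero = f
  ar (suc i) = arc W i
  tk : ∀ i → tl G (ar i) ≡ nd (inject₁ i)
  tk zero = refl
  tk (suc i) = tl-ok W i
  hk : ∀ i → hd G (ar i) ≡ nd (suc i)
  hk zero = p
  hk (suc i) = hd-ok W i

-- Omnitig: W = e_0 ... e_ℓ (ℓ+1 arcs) such that for all 1 ≤ i ≤ j ≤ ℓ there is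
-- no non-empty path from t(e_j) to h(e_{i-1}) whose first arc differs from e_j
-- and whose last arc differs from e_{i-1}.  (Below a = i-1, b = j, so a < b.)
IsOmnitig : ∀ {G ℓ} → Walk G (suc ℓ) → Set
IsOmnitig {G} {ℓ} W = ∀ (a b : Fin (suc ℓ)) → toℕ a < toℕ b →
  ∀ k (Q : Walk G (suc k)) → IsPath Q →
  start Q ≡ tl G (arc W b) → end Q ≡ hd G (arc W a) →
  arc Q zero ≢ arc W b → arc Q (fromℕ k) ≢ arc W a → ⊥

StronglyConnected : Graph → Set
StronglyConnected G = ∀ (u v : Node G) → Σ ℕ λ ℓ → Σ (Walk G ℓ) λ W → start W ≡ u × end W ≡ v

-- G consists of a single cycle: there is a closed path (length ≥ 1) containing
-- every node and every arc of G (its arcs are then automatically pairwise distinct).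
IsClosedPath : Graph → Set
IsClosedPath G = Σ ℕ λ k → Σ (Walk G (suc k)) λ C →
  IsPath C × start C ≡ end C ×
  (∀ v → ∃ λ i → node C i ≡ v) × (∀ e → ∃ λ i → arc C i ≡ e)

-- Write f W = e₀ e₁ … e_ℓ with e₀ = f and W_i = h(e_i), and let v = h(f). As v is a join
-- node there is an arc g ≠ f into v, and strong connectivity closes g into a cycle Γ through
-- v whose last arc is g. The omnitig f W must follow Γ: if the arc leaving W_i differed
-- from the arc of Γ there, the rest of Γ would be a path from that arc's tail to h(f)
-- avoiding both it and f, which the omnitig forbids. So W winds around Γ, W_i being the
-- node at position i mod |Γ|.
-- If P met W internally, let W_x be its last internal node on W; the rest S of P runs from
-- W_x to W_c with first and last arcs off f W and without passing through v. If the position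
-- q of W_c on Γ is at most x, S itself is a forbidden path from t(e_(x+1)) to h(e_q);
-- otherwise following S to its first node on Γ at a position ≥ q and then Γ back to v gives
-- a forbidden path from t(e_(x+1)) to h(f).

module Submission where

open import Defs
open import Data.Nat using (ℕ; zero; suc; _+_; _*_; _∸_; _%_; _/_; NonZero; _≤_; _<_; z≤n; s≤s; z<s; _<?_; _≤?_)
open import Data.Nat.Properties
open import Data.Nat.DivMod using (m≡m%n+[m/n]*n; [m+kn]%n≡m%n; n%n≡0; m<n⇒m%n≡m; m%n<n; m%n≤m)
open import Data.Nat.Induction using (<-wellFounded)
open import Induction.WellFounded using (Acc; acc)
open import Data.Fin as Fin using (Fin; toℕ; fromℕ; fromℕ<; inject₁)
open import Data.Fin.Properties using (toℕ-fromℕ<; toℕ-fromℕ; toℕ-inject₁; toℕ-injective; toℕ<n)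
open import Data.Product using (Σ; ∃; _×_; _,_)
open import Data.Sum using (_⊎_; inj₁; inj₂; [_,_]′)
open import Data.Empty using (⊥; ⊥-elim)
open import Relation.Nullary using (¬_; yes; no; _×-dec_; contradiction)
open import Relation.Unary using (Decidable)
open import Relation.Binary using (tri<; tri≈; tri>)
open import Relation.Binary.PropositionalEquality
open import Relation.Binary.Definitions using (DecidableEquality)
open import Function using (_∘_)
open import Data.List using (List; []; _∷_; length; filter; allFin)
open import Data.List.Relation.Unary.All using (All; _∷_)
open import Data.List.Relation.Unary.All.Properties using (all-filter)
open import Data.List.Relation.Unary.AllPairs using (_∷_)
open import Data.List.Relation.Unary.Unique.Propositional using (Unique)
import Data.List.Relation.Unary.Unique.Propositional.Properties as Unique

module _ {P : ℕ → Set} (P? : Decidable P) where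

  least : ∀ {n} → P n → ∃ λ m → m ≤ n × P m × (∀ {j} → j < m → ¬ P j)
  least {n} = go (<-wellFounded n)
    where
    go : ∀ {n} → Acc _<_ n → P n → ∃ λ m → m ≤ n × P m × (∀ {j} → j < m → ¬ P j)
    go {n} (acc below) pn with anyUpTo? P? n
    ... | no none = n , ≤-refl , pn , λ j<n pj → none (_ , j<n , pj)
    ... | yes (j , j<n , pj) with go (below j<n) pj
    ...   | m , m≤j , pm , minimal = m , ≤-trans m≤j (<⇒≤ j<n) , pm , minimal

  greatestBelow : ∀ n {r} → r < n → P r →
    ∃ λ m → r ≤ m × m < n × P m × (∀ {j} → m < j → j < n → ¬ P j)
  greatestBelow (suc n) {r} r<1+n pr with P? n | m≤n⇒m<n∨m≡n (≤-pred r<1+n)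
  ... | yes pn | _ = n , ≤-pred r<1+n , ≤-refl , pn , λ n<j j<1+n _ → <-irrefl refl (<-≤-trans n<j (≤-pred j<1+n))
  ... | no ¬pn | inj₂ refl = contradiction pr ¬pn
  ... | no ¬pn | inj₁ r<n with greatestBelow n r<n pr
  ...   | m , r≤m , m<n , pm , maximal = m , r≤m , m<n⇒m<1+n m<n , pm , maximal′
    where
    maximal′ : ∀ {j} → m < j → j < suc n → ¬ P j
    maximal′ {j} m<j j<1+n with m≤n⇒m<n∨m≡n (≤-pred j<1+n)
    ... | inj₁ j<n = maximal m<j j<n
    ... | inj₂ refl = ¬pn

otherMember : ∀ {A : Set} {P : A → Set} (_≟_ : DecidableEquality A) {xs : List A} →
  Unique xs → All P xs → 1 < length xs → ∀ a → ∃ λ b → b ≢ a × P b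
otherMember _≟_ {x ∷ y ∷ _} ((x≢y ∷ _) ∷ _) (px ∷ py ∷ _) _ a with x ≟ a
... | yes refl = y , x≢y ∘ sym , py
... | no  x≢a  = x , x≢a , px
otherMember _≟_ {_ ∷ []} _ _ (s≤s ()) _

suc-% : ∀ i n .{{_ : NonZero n}} → suc i % n ≡ suc (i % n) % n
suc-% i n = begin
  suc i % n                         ≡⟨ cong (λ j → suc j % n) (m≡m%n+[m/n]*n i n) ⟩
  (suc (i % n) + (i / n) * n) % n   ≡⟨ [m+kn]%n≡m%n (suc (i % n)) (i / n) n ⟩
  suc (i % n) % n                   ∎
  where open ≡-Reasoning

module _ {A : Set} where

  lookupOr : ∀ {n} → A → (Fin n → A) → ℕ → A
  lookupOr {zero}  a f _       = a
  lookupOr {suc n} a f zero    = f Fin.zero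
  lookupOr {suc n} a f (suc i) = lookupOr a (λ x → f (Fin.suc x)) i

  lookupOr-toℕ : ∀ {n} a (f : Fin n → A) i → lookupOr a f (toℕ i) ≡ f i
  lookupOr-toℕ a f Fin.zero    = refl
  lookupOr-toℕ a f (Fin.suc i) = lookupOr-toℕ a (λ x → f (Fin.suc x)) i

  lookupOr-< : ∀ {n} a (f : Fin n → A) {i} (i<n : i < n) → lookupOr a f i ≡ f (fromℕ< i<n)
  lookupOr-< a f i<n = trans (cong (lookupOr a f) (sym (toℕ-fromℕ< i<n))) (lookupOr-toℕ a f _)

  append : (ℕ → A) → ℕ → (ℕ → A) → ℕ → A
  append f m g i with i <? m
  ... | yes _ = f i
  ... | no  _ = g (i ∸ m)

  append-< : ∀ f m g {i} → i < m → append f m g i ≡ f i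
  append-< f m g {i} i<m with i <? m
  ... | yes _   = refl
  ... | no  i≮m = contradiction i<m i≮m

  append-+ : ∀ f m g j → append f m g (m + j) ≡ g j
  append-+ f m g j with m + j <? m
  ... | yes m+j<m = contradiction m+j<m (≤⇒≯ (m≤m+n m j))
  ... | no  _     = cong g (m+n∸m≡n m j)

  append-≤ : ∀ f m g → f m ≡ g 0 → ∀ {i} → i ≤ m → append f m g i ≡ f i
  append-≤ f m g joint i≤m with m≤n⇒m<n∨m≡n i≤m
  ... | inj₁ i<m  = append-< f m g i<m
  ... | inj₂ refl = begin
    append f m g m       ≡⟨ cong (append f m g) (sym (+-identityʳ m)) ⟩
    append f m g (m + 0) ≡⟨ append-+ f m g 0 ⟩
    g 0                  ≡⟨ sym joint ⟩
    f m                  ∎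
    where open ≡-Reasoning

data SplitAt (m : ℕ) : ℕ → Set where
  left  : ∀ {i} → i ≤ m → SplitAt m i
  right : ∀ j → SplitAt m (m + suc j)

splitAt : ∀ m i → SplitAt m i
splitAt zero    zero    = left z≤n
splitAt zero    (suc i) = right i
splitAt (suc m) zero    = left z≤n
splitAt (suc m) (suc i) with splitAt m i
... | left i≤m = left (s≤s i≤m)
... | right j  = right j

SameUpToEnds : ℕ → ℕ → ℕ → Set
SameUpToEnds n i j = i ≡ j ⊎ (i ≡ 0 × j ≡ n) ⊎ (i ≡ n × j ≡ 0)

module _ (G : Graph) where

  -- Nodes past position n and arcs from position n on are junk.
  record Walkℕ (n : ℕ) : Set where
    field
      nd : ℕ → Node G
      ar : ℕ → Arc G
      tl-ar : ∀ {i} → i < n → tl G (ar i) ≡ nd i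
      hd-ar : ∀ {i} → i < n → hd G (ar i) ≡ nd (suc i)

  open Walkℕ public

  IsPathℕ : ∀ {n} → Walkℕ n → Set
  IsPathℕ {n} w = ∀ {i j} → i ≤ n → j ≤ n → nd w i ≡ nd w j → SameUpToEnds n i j

  HasDistinctNodes : ∀ {n} → Walkℕ n → Set
  HasDistinctNodes {n} w = ∀ {i j} → i ≤ n → j ≤ n → nd w i ≡ nd w j → i ≡ j

  distinct⇒path : ∀ {n} (w : Walkℕ n) → HasDistinctNodes w → IsPathℕ w
  distinct⇒path w distinct i≤n j≤n eq = inj₁ (distinct i≤n j≤n eq)

  cast : ∀ {m n} → m ≡ n → Walkℕ m → Walkℕ n
  cast m≡n w = record
    { nd = nd w ; ar = ar w
    ; tl-ar = λ i<n → tl-ar w (subst (_ <_) (sym m≡n) i<n)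
    ; hd-ar = λ i<n → hd-ar w (subst (_ <_) (sym m≡n) i<n) }

  prefix : ∀ {n} e → e ≤ n → Walkℕ n → Walkℕ e
  prefix e e≤n w = record
    { nd = nd w ; ar = ar w
    ; tl-ar = λ i<e → tl-ar w (<-≤-trans i<e e≤n)
    ; hd-ar = λ i<e → hd-ar w (<-≤-trans i<e e≤n) }

  suffix : ∀ {n} e s → e + s ≡ n → Walkℕ n → Walkℕ e
  suffix e s e+s≡n w = record
    { nd = λ i → nd w (i + s) ; ar = λ i → ar w (i + s)
    ; tl-ar = λ i<e → tl-ar w (within i<e)
    ; hd-ar = λ i<e → hd-ar w (within i<e) }
    where
    within : ∀ {i} → i < e → i + s < _
    within i<e = subst (_ <_) e+s≡n (+-monoˡ-< s i<e)

  concat : ∀ {m n} (w₁ : Walkℕ m) (w₂ : Walkℕ n) → nd w₁ m ≡ nd w₂ 0 → Walkℕ (m + n)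
  concat {m} {n} w₁ w₂ joint = record
    { nd = append (nd w₁) m (nd w₂) ; ar = append (ar w₁) m (ar w₂)
    ; tl-ar = tl-ar′ ; hd-ar = hd-ar′ }
    where
    offset : ∀ {i} → ¬ i < m → m + (i ∸ m) ≡ i
    offset i≮m = m+[n∸m]≡n (≮⇒≥ i≮m)
    within : ∀ {i} → i < m + n → ¬ i < m → i ∸ m < n
    within i<m+n i≮m = +-cancelˡ-< m _ _ (subst (_< m + n) (sym (offset i≮m)) i<m+n)
    tl-ar′ : ∀ {i} → i < m + n → tl G (append (ar w₁) m (ar w₂) i) ≡ append (nd w₁) m (nd w₂) i
    tl-ar′ {i} i<m+n with i <? m
    ... | yes i<m = tl-ar w₁ i<m
    ... | no  i≮m = tl-ar w₂ (within i<m+n i≮m)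
    hd-ar′ : ∀ {i} → i < m + n → hd G (append (ar w₁) m (ar w₂) i) ≡ append (nd w₁) m (nd w₂) (suc i)
    hd-ar′ {i} i<m+n with i <? m
    ... | yes i<m = trans (hd-ar w₁ i<m) (sym (append-≤ (nd w₁) m (nd w₂) joint i<m))
    ... | no  i≮m = begin
      hd G (ar w₂ (i ∸ m))                          ≡⟨ hd-ar w₂ (within i<m+n i≮m) ⟩
      nd w₂ (suc (i ∸ m))                           ≡⟨ append-+ (nd w₁) m (nd w₂) (suc (i ∸ m)) ⟨
      append (nd w₁) m (nd w₂) (m + suc (i ∸ m))    ≡⟨ cong (append (nd w₁) m (nd w₂)) (trans (+-suc m _) (cong suc (offset i≮m))) ⟩
      append (nd w₁) m (nd w₂) (suc i)              ∎
      where open ≡-Reasoning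

  module _ {m n} (w₁ : Walkℕ m) (w₂ : Walkℕ n) (joint : nd w₁ m ≡ nd w₂ 0) where

    concat-nd-≤ : ∀ {i} → i ≤ m → nd (concat w₁ w₂ joint) i ≡ nd w₁ i
    concat-nd-≤ = append-≤ (nd w₁) m (nd w₂) joint

    concat-nd-+ : ∀ j → nd (concat w₁ w₂ joint) (m + j) ≡ nd w₂ j
    concat-nd-+ = append-+ (nd w₁) m (nd w₂)

    concat-ar-< : ∀ {i} → i < m → ar (concat w₁ w₂ joint) i ≡ ar w₁ i
    concat-ar-< = append-< (ar w₁) m (ar w₂)

    concat-ar-+ : ∀ j → ar (concat w₁ w₂ joint) (m + j) ≡ ar w₂ j
    concat-ar-+ = append-+ (ar w₁) m (ar w₂)

  cast-path : ∀ {m n} (eq : m ≡ n) (w : Walkℕ m) → IsPathℕ w → IsPathℕ (cast eq w)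
  cast-path refl w path = path

  prefix-path : ∀ {n e} (e≤n : e ≤ n) (w : Walkℕ n) → IsPathℕ w → IsPathℕ (prefix e e≤n w)
  prefix-path {n} {e} e≤n w path i≤e j≤e eq with path (≤-trans i≤e e≤n) (≤-trans j≤e e≤n) eq
  ... | inj₁ i≡j               = inj₁ i≡j
  ... | inj₂ (inj₁ (i≡0 , j≡n)) = inj₂ (inj₁ (i≡0 , ≤-antisym j≤e (subst (e ≤_) (sym j≡n) e≤n)))
  ... | inj₂ (inj₂ (i≡n , j≡0)) = inj₂ (inj₂ (≤-antisym i≤e (subst (e ≤_) (sym i≡n) e≤n) , j≡0))

  suffix-path : ∀ {n e s} (e+s≡n : e + s ≡ n) (w : Walkℕ n) → IsPathℕ w → IsPathℕ (suffix e s e+s≡n w)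
  suffix-path {n} {e} {s} e+s≡n w path i≤e j≤e eq with path (shift i≤e) (shift j≤e) eq
    where
    shift : ∀ {i} → i ≤ e → i + s ≤ n
    shift i≤e = subst (_ ≤_) e+s≡n (+-monoˡ-≤ s i≤e)
  ... | inj₁ eq′               = inj₁ (+-cancelʳ-≡ s _ _ eq′)
  ... | inj₂ (inj₁ (i≡0 , j≡n)) = inj₂ (inj₁ (m+n≡0⇒m≡0 _ i≡0 , +-cancelʳ-≡ s _ _ (trans j≡n (sym e+s≡n))))
  ... | inj₂ (inj₂ (i≡n , j≡0)) = inj₂ (inj₂ (+-cancelʳ-≡ s _ _ (trans i≡n (sym e+s≡n)) , m+n≡0⇒m≡0 _ j≡0))


  module _ {m n} (w₁ : Walkℕ m) (w₂ : Walkℕ n) (joint : nd w₁ m ≡ nd w₂ 0)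
           (path₁ : IsPathℕ w₁) (path₂ : IsPathℕ w₂)
           (cross : ∀ {i j} → i ≤ m → j ≤ n → nd w₁ i ≡ nd w₂ j → (i ≡ m × j ≡ 0) ⊎ (i ≡ 0 × j ≡ n)) where

    private
      C = concat w₁ w₂ joint

      meetsStart : ∀ {i} → i ≤ m → nd w₁ i ≡ nd w₂ 0 → i ≡ m ⊎ n ≡ 0
      meetsStart i≤m eq with cross i≤m z≤n eq
      ... | inj₁ (i≡m , _) = inj₁ i≡m
      ... | inj₂ (_ , 0≡n) = inj₂ (sym 0≡n)

      m≡m+n : n ≡ 0 → m ≡ m + n
      m≡m+n n≡0 = sym (trans (cong (m +_) n≡0) (+-identityʳ m))

      bothLeft : ∀ {i j} → i ≤ m → j ≤ m → nd w₁ i ≡ nd w₁ j → SameUpToEnds (m + n) i j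
      bothLeft i≤m j≤m eq with path₁ i≤m j≤m eq
      ... | inj₁ i≡j = inj₁ i≡j
      ... | inj₂ (inj₁ (i≡0 , refl)) with meetsStart i≤m (trans eq joint)
      ...   | inj₁ i≡m = inj₁ i≡m
      ...   | inj₂ n≡0 = inj₂ (inj₁ (i≡0 , m≡m+n n≡0))
      bothLeft i≤m j≤m eq | inj₂ (inj₂ (refl , j≡0)) with meetsStart j≤m (trans (sym eq) joint)
      ...   | inj₁ j≡m = inj₁ (sym j≡m)
      ...   | inj₂ n≡0 = inj₂ (inj₂ (m≡m+n n≡0 , j≡0))

    concat-path : IsPathℕ C
    concat-path {i} {j} i≤ j≤ eq with splitAt m i | splitAt m j
    ... | left i≤m | left j≤m =
      bothLeft i≤m j≤m (trans (sym (concat-nd-≤ w₁ w₂ joint i≤m)) (trans eq (concat-nd-≤ w₁ w₂ joint j≤m)))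
    ... | left i≤m | right b
      with cross i≤m (+-cancelˡ-≤ m _ _ j≤) (trans (sym (concat-nd-≤ w₁ w₂ joint i≤m)) (trans eq (concat-nd-+ w₁ w₂ joint (suc b))))
    ...   | inj₂ (i≡0 , 1+b≡n) = inj₂ (inj₁ (i≡0 , cong (m +_) 1+b≡n))
    concat-path i≤ j≤ eq | right a | left j≤m
      with cross j≤m (+-cancelˡ-≤ m _ _ i≤) (trans (sym (concat-nd-≤ w₁ w₂ joint j≤m)) (trans (sym eq) (concat-nd-+ w₁ w₂ joint (suc a))))
    ...   | inj₂ (j≡0 , 1+a≡n) = inj₂ (inj₂ (cong (m +_) 1+a≡n , j≡0))
    concat-path i≤ j≤ eq | right a | right b
      with path₂ (+-cancelˡ-≤ m _ _ i≤) (+-cancelˡ-≤ m _ _ j≤) (trans (sym (concat-nd-+ w₁ w₂ joint (suc a))) (trans eq (concat-nd-+ w₁ w₂ joint (suc b))))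
    ...   | inj₁ 1+a≡1+b = inj₁ (cong (m +_) 1+a≡1+b)
    ...   | inj₂ (inj₁ (() , _))
    ...   | inj₂ (inj₂ (_ , ()))

  removeLoop : ∀ {n i j} (w : Walkℕ n) → i < j → j ≤ n → nd w i ≡ nd w j →
    Σ (Walkℕ (i + (n ∸ j))) λ w′ → nd w′ 0 ≡ nd w 0 × nd w′ (i + (n ∸ j)) ≡ nd w n
  removeLoop {n} {i} {j} w i<j j≤n eq =
    concat before after eq ,
    concat-nd-≤ before after eq z≤n ,
    trans (concat-nd-+ before after eq (n ∸ j)) (cong (nd w) (m∸n+n≡m j≤n))
    where
    before = prefix i (≤-trans (<⇒≤ i<j) j≤n) w
    after  = suffix (n ∸ j) j (m∸n+n≡m j≤n) w

  shortcut : ∀ {n} (w : Walkℕ n) →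
    ∃ λ n′ → Σ (Walkℕ n′) λ w′ → HasDistinctNodes w′ × nd w′ 0 ≡ nd w 0 × nd w′ n′ ≡ nd w n
  shortcut w = go (<-wellFounded _) w
    where
    go : ∀ {n} → Acc _<_ n → (w : Walkℕ n) →
      ∃ λ n′ → Σ (Walkℕ n′) λ w′ → HasDistinctNodes w′ × nd w′ 0 ≡ nd w 0 × nd w′ n′ ≡ nd w n
    go {n} (acc shorter) w with anyUpTo? (λ j → anyUpTo? (λ i → nd w i Fin.≟ nd w j) j) (suc n)
    ... | no noRepeat = n , w , distinct , refl , refl
      where
      distinct : HasDistinctNodes w
      distinct {i} {j} i≤n j≤n eq with <-cmp i j
      ... | tri< i<j _ _ = contradiction (j , s≤s j≤n , i , i<j , eq) noRepeat
      ... | tri≈ _ i≡j _ = i≡j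
      ... | tri> _ _ j<i = contradiction (i , s≤s i≤n , j , j<i , sym eq) noRepeat
    ... | yes (j , s≤s j≤n , i , i<j , eq) with removeLoop w i<j j≤n eq
    ...   | w₁ , start₁ , end₁ with go (shorter (subst (i + (n ∸ j) <_) (m+[n∸m]≡n j≤n) (+-monoˡ-< (n ∸ j) i<j))) w₁
    ...     | n′ , w′ , distinct , start , end = n′ , w′ , distinct , trans start start₁ , trans end end₁

  -- The given arc is the junk value of ar past the end: a walk of length 0 has no arc to reuse.
  toWalkℕ : ∀ {n} → Arc G → Walk G n → Walkℕ n
  toWalkℕ {n} d W = record { nd = nodeℕ ; ar = lookupOr d (arc W) ; tl-ar = tl-ar′ ; hd-ar = hd-ar′ }
    where
    open ≡-Reasoning
    nodeℕ : ℕ → Node G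
    nodeℕ = lookupOr (node W Fin.zero) (node W)
    tl-ar′ : ∀ {i} → i < n → tl G (lookupOr d (arc W) i) ≡ nodeℕ i
    tl-ar′ {i} i<n = begin
      tl G (lookupOr d (arc W) i)      ≡⟨ cong (tl G) (lookupOr-< d (arc W) i<n) ⟩
      tl G (arc W (fromℕ< i<n))        ≡⟨ tl-ok W (fromℕ< i<n) ⟩
      node W (inject₁ (fromℕ< i<n))    ≡⟨ lookupOr-toℕ _ (node W) _ ⟨
      nodeℕ (toℕ (inject₁ (fromℕ< i<n))) ≡⟨ cong nodeℕ (trans (toℕ-inject₁ _) (toℕ-fromℕ< i<n)) ⟩
      nodeℕ i                          ∎
    hd-ar′ : ∀ {i} → i < n → hd G (lookupOr d (arc W) i) ≡ nodeℕ (suc i)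
    hd-ar′ {i} i<n = begin
      hd G (lookupOr d (arc W) i)      ≡⟨ cong (hd G) (lookupOr-< d (arc W) i<n) ⟩
      hd G (arc W (fromℕ< i<n))        ≡⟨ hd-ok W (fromℕ< i<n) ⟩
      node W (Fin.suc (fromℕ< i<n))    ≡⟨ lookupOr-toℕ _ (node W) _ ⟨
      nodeℕ (suc (toℕ (fromℕ< i<n)))   ≡⟨ cong (nodeℕ ∘ suc) (toℕ-fromℕ< i<n) ⟩
      nodeℕ (suc i)                    ∎

  module _ {n} (d : Arc G) (W : Walk G n) where

    toWalkℕ-nd : ∀ i → nd (toWalkℕ d W) (toℕ i) ≡ node W i
    toWalkℕ-nd = lookupOr-toℕ _ (node W)

    toWalkℕ-ar : ∀ i → ar (toWalkℕ d W) (toℕ i) ≡ arc W i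
    toWalkℕ-ar = lookupOr-toℕ d (arc W)

    toWalkℕ-end : nd (toWalkℕ d W) n ≡ end W
    toWalkℕ-end = trans (cong (nd (toWalkℕ d W)) (sym (toℕ-fromℕ n))) (toWalkℕ-nd (fromℕ n))

    toWalkℕ-path : IsPath W → IsPathℕ (toWalkℕ d W)
    toWalkℕ-path path {i} {j} i≤n j≤n eq with path (fromℕ< (s≤s i≤n)) (fromℕ< (s≤s j≤n)) eq′
      where
      eq′ = trans (sym (lookupOr-< _ (node W) (s≤s i≤n))) (trans eq (lookupOr-< _ (node W) (s≤s j≤n)))
    ... | inj₁ i≡j = inj₁ (trans (sym (toℕ-fromℕ< _)) (trans (cong toℕ i≡j) (toℕ-fromℕ< _)))
    ... | inj₂ (inj₁ (i≡0 , j≡n)) = inj₂ (inj₁ (trans (sym (toℕ-fromℕ< _)) i≡0 , trans (sym (toℕ-fromℕ< _)) j≡n))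
    ... | inj₂ (inj₂ (i≡n , j≡0)) = inj₂ (inj₂ (trans (sym (toℕ-fromℕ< _)) i≡n , trans (sym (toℕ-fromℕ< _)) j≡0))

  fromWalkℕ : ∀ {n} → Walkℕ n → Walk G n
  fromWalkℕ {n} w = record
    { node = λ x → nd w (toℕ x) ; arc = λ x → ar w (toℕ x)
    ; tl-ok = λ x → trans (tl-ar w (toℕ<n x)) (cong (nd w) (sym (toℕ-inject₁ x)))
    ; hd-ok = λ x → hd-ar w (toℕ<n x) }

  fromWalkℕ-path : ∀ {n} (w : Walkℕ n) → IsPathℕ w → IsPath (fromWalkℕ w)
  fromWalkℕ-path w path x y eq with path (≤-pred (toℕ<n x)) (≤-pred (toℕ<n y)) eq
  ... | inj₁ x≡y = inj₁ (toℕ-injective x≡y)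
  ... | inj₂ ends = inj₂ ends

  IsOmnitigℕ : ∀ {n} → Walkℕ n → Set
  IsOmnitigℕ {n} F = ∀ {a b} → a < b → b < n → ∀ {k} (Q : Walkℕ (suc k)) → IsPathℕ Q →
    nd Q 0 ≡ tl G (ar F b) → nd Q (suc k) ≡ hd G (ar F a) → ar Q 0 ≢ ar F b → ar Q k ≢ ar F a → ⊥

  toWalkℕ-omnitig : ∀ {ℓ} (d : Arc G) (W : Walk G (suc ℓ)) → IsOmnitig W → IsOmnitigℕ (toWalkℕ d W)
  toWalkℕ-omnitig d W omnitig {a} {b} a<b b<n {k} Q path start end first last =
    omnitig (fromℕ< a<n) (fromℕ< b<n) (subst₂ _<_ (sym (toℕ-fromℕ< a<n)) (sym (toℕ-fromℕ< b<n)) a<b)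
      k (fromWalkℕ Q) (fromWalkℕ-path Q path)
      (trans start (cong (tl G) arc-b))
      (trans (cong (nd Q) (toℕ-fromℕ (suc k))) (trans end (cong (hd G) arc-a)))
      (λ eq → first (trans eq (sym arc-b)))
      (λ eq → last (trans (cong (ar Q) (sym (toℕ-fromℕ k))) (trans eq (sym arc-a))))
    where
    a<n = <-trans a<b b<n
    arc-a : ar (toWalkℕ d W) a ≡ arc W (fromℕ< a<n)
    arc-a = lookupOr-< d (arc W) a<n
    arc-b : ar (toWalkℕ d W) b ≡ arc W (fromℕ< b<n)
    arc-b = lookupOr-< d (arc W) b<n

  anotherInArc : ∀ {f} → IsJoinArc G f → ∃ λ g → g ≢ f × hd G g ≡ hd G f
  anotherInArc {f} join = otherMember Fin._≟_
    (Unique.filter⁺ (λ e → hd G e Fin.≟ hd G f) (Unique.allFin⁺ (m G)))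
    (all-filter (λ e → hd G e Fin.≟ hd G f) (allFin (m G))) join f

  arcWalk : Arc G → Walkℕ 1
  arcWalk g = record { nd = λ { zero → tl G g ; (suc _) → hd G g } ; ar = λ _ → g
                     ; tl-ar = λ { {zero} _ → refl ; {suc _} (s≤s ()) }
                     ; hd-ar = λ { {zero} _ → refl ; {suc _} (s≤s ()) } }

  arcWalk-path : ∀ g → IsPathℕ (arcWalk g)
  arcWalk-path g z≤n       z≤n       _ = inj₁ refl
  arcWalk-path g z≤n       (s≤s z≤n) _ = inj₂ (inj₁ (refl , refl))
  arcWalk-path g (s≤s z≤n) z≤n       _ = inj₂ (inj₂ (refl , refl))
  arcWalk-path g (s≤s z≤n) (s≤s z≤n) _ = inj₁ refl

  cycleThroughOtherInArc : StronglyConnected G → ∀ {f} → IsJoinArc G f →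
    ∃ λ m → Σ (Walkℕ (suc m)) λ Γ →
      IsPathℕ Γ × nd Γ 0 ≡ hd G f × nd Γ (suc m) ≡ hd G f × ar Γ m ≢ f
  cycleThroughOtherInArc connected {f} join with anotherInArc join
  ... | g , g≢f , hd-g with connected (hd G f) (tl G g)
  ... | L , W , W-start , W-end with shortcut (toWalkℕ g W)
  ... | n , Z , distinct , Z-start , Z-end =
    n , cast (+-comm n 1) C , cast-path (+-comm n 1) C C-path ,
    trans (concat-nd-≤ Z (arcWalk g) joint z≤n) (trans Z-start W-start) ,
    trans (cong (nd C) (+-comm 1 n)) (trans (concat-nd-+ Z (arcWalk g) joint 1) hd-g) ,
    λ eq → g≢f (trans (sym (concat-ar-+ Z (arcWalk g) joint 0)) (trans (cong (ar C) (+-identityʳ n)) eq))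
    where
    joint : nd Z n ≡ tl G g
    joint = trans Z-end (trans (toWalkℕ-end g W) W-end)
    C = concat Z (arcWalk g) joint
    cross : ∀ {i j} → i ≤ n → j ≤ 1 → nd Z i ≡ nd (arcWalk g) j → (i ≡ n × j ≡ 0) ⊎ (i ≡ 0 × j ≡ 1)
    cross i≤n z≤n       eq = inj₁ (distinct i≤n (≤-refl {n}) (trans eq (sym joint)) , refl)
    cross i≤n (s≤s z≤n) eq = inj₂ (distinct {j = 0} i≤n z≤n (trans eq (trans hd-g (sym (trans Z-start W-start)))) , refl)
    C-path : IsPathℕ C
    C-path = concat-path Z (arcWalk g) joint (distinct⇒path Z distinct) (arcWalk-path g) cross

  module _ {m} (Γ : Walkℕ (suc m)) (Γ-path : IsPathℕ Γ) {x q} (x<q : x < q) (q<1+m : q < suc m)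
           {n} (S : Walkℕ (suc n)) (S-path : IsPathℕ S)
           (S-start : nd S 0 ≡ nd Γ x) (S-end : nd S (suc n) ≡ nd Γ q)
           (S-avoids : ∀ {i} → 0 < i → i < suc n → nd S i ≢ nd Γ (suc m)) where

    private
      ReachesLater : ℕ → Set
      ReachesLater i = 0 < i × ∃ λ t → t < suc (suc m) × q ≤ t × nd S i ≡ nd Γ t

      reachesLater? : Decidable ReachesLater
      reachesLater? i = (0 <? i) ×-dec anyUpTo? (λ t → (q ≤? t) ×-dec (nd S i Fin.≟ nd Γ t)) (suc (suc m))

      x<1+m : x < suc m
      x<1+m = <-trans x<q q<1+m

      module _ {i₀ t₀} (i₀≤1+n : suc i₀ ≤ suc n) (t₀≤1+m : t₀ ≤ suc m) (q≤t₀ : q ≤ t₀)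
               (hit : nd S (suc i₀) ≡ nd Γ t₀) (first : ∀ {i} → i < suc i₀ → ¬ ReachesLater i) where

        x<t₀ : x < t₀
        x<t₀ = <-≤-trans x<q q≤t₀

        t₀<1+m : t₀ < suc m
        t₀<1+m with m≤n⇒m<n∨m≡n t₀≤1+m | m≤n⇒m<n∨m≡n i₀≤1+n
        ... | inj₁ t₀<1+m | _ = t₀<1+m
        ... | inj₂ refl | inj₁ i₀<1+n = contradiction hit (S-avoids z<s i₀<1+n)
        ... | inj₂ refl | inj₂ refl with Γ-path (<⇒≤ q<1+m) ≤-refl (trans (sym S-end) hit)
        ...   | inj₁ q≡1+m = contradiction q≡1+m (<⇒≢ q<1+m)
        ...   | inj₂ (inj₁ (refl , _)) = contradiction x<q λ ()
        ...   | inj₂ (inj₂ (q≡1+m , _)) = contradiction q≡1+m (<⇒≢ q<1+m)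

        j = m ∸ t₀
        j+t₀≡m : j + t₀ ≡ m
        j+t₀≡m = m∸n+n≡m (≤-pred t₀<1+m)

        A = prefix (suc i₀) i₀≤1+n S
        B = suffix (suc j) t₀ (cong suc j+t₀≡m) Γ
        Q = concat A B hit

        k+t₀≤1+m : ∀ {k} → k ≤ suc j → k + t₀ ≤ suc m
        k+t₀≤1+m {k} k≤1+j = subst (k + t₀ ≤_) (cong suc j+t₀≡m) (+-monoˡ-≤ t₀ k≤1+j)

        cross : ∀ {i k} → i ≤ suc i₀ → k ≤ suc j → nd S i ≡ nd Γ (k + t₀) →
          (i ≡ suc i₀ × k ≡ 0) ⊎ (i ≡ 0 × k ≡ suc j)
        cross {zero} {k} _ k≤1+j eq with Γ-path (<⇒≤ x<1+m) (k+t₀≤1+m k≤1+j) (trans (sym S-start) eq)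
        ... | inj₁ x≡k+t₀ = contradiction x≡k+t₀ (<⇒≢ (<-≤-trans x<t₀ (m≤n+m t₀ k)))
        ... | inj₂ (inj₁ (_ , k+t₀≡1+m)) = inj₂ (refl , +-cancelʳ-≡ t₀ _ _ (trans k+t₀≡1+m (cong suc (sym j+t₀≡m))))
        ... | inj₂ (inj₂ (x≡1+m , _)) = contradiction x≡1+m (<⇒≢ x<1+m)
        cross {suc i} {k} 1+i≤1+i₀ k≤1+j eq with m≤n⇒m<n∨m≡n 1+i≤1+i₀
        ... | inj₁ 1+i<1+i₀ =
          contradiction (z<s , k + t₀ , s≤s (k+t₀≤1+m k≤1+j) , ≤-trans q≤t₀ (m≤n+m t₀ k) , eq) (first 1+i<1+i₀)
        ... | inj₂ refl with Γ-path t₀≤1+m (k+t₀≤1+m k≤1+j) (trans (sym hit) eq)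
        ...   | inj₁ t₀≡k+t₀ = inj₁ (refl , +-cancelʳ-≡ t₀ k 0 (sym t₀≡k+t₀))
        ...   | inj₂ (inj₁ (refl , _)) = contradiction x<t₀ λ ()
        ...   | inj₂ (inj₂ (t₀≡1+m , _)) = contradiction t₀≡1+m (<⇒≢ t₀<1+m)

        spliced : ∃ λ k → Σ (Walkℕ (suc k)) λ Q →
          IsPathℕ Q × nd Q 0 ≡ nd Γ x × nd Q (suc k) ≡ nd Γ (suc m) × ar Q 0 ≡ ar S 0 × ar Q k ≡ ar Γ m
        spliced = i₀ + suc j , Q ,
          concat-path A B hit (prefix-path i₀≤1+n S S-path) (suffix-path (cong suc j+t₀≡m) Γ Γ-path) cross ,
          trans (concat-nd-≤ A B hit z≤n) S-start ,
          trans (concat-nd-+ A B hit (suc j)) (cong (nd Γ ∘ suc) j+t₀≡m) ,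
          concat-ar-< A B hit z<s ,
          trans (cong (ar Q) (+-suc i₀ j)) (trans (concat-ar-+ A B hit j) (cong (ar Γ) j+t₀≡m))

    -- Follow S to its first node on Γ at a position t ≥ q, then Γ from t to its end.
    spliceIntoCycle : ∃ λ k → Σ (Walkℕ (suc k)) λ Q →
      IsPathℕ Q × nd Q 0 ≡ nd Γ x × nd Q (suc k) ≡ nd Γ (suc m) × ar Q 0 ≡ ar S 0 × ar Q k ≡ ar Γ m
    spliceIntoCycle with least reachesLater? {suc n} (z<s , q , m<n⇒m<1+n q<1+m , ≤-refl , S-end)
    ... | suc i₀ , i₀≤n , (_ , t₀ , t₀<2+m , q≤t₀ , hit) , first =
      spliced i₀≤n (≤-pred t₀<2+m) q≤t₀ hit first

  -- F = e₀ … e_ℓ plays the role of f W, so node i of W is nd F (suc i).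
  module _ {ℓ} (F : Walkℕ (suc ℓ)) (omnitig : IsOmnitigℕ F)
           {m} (Γ : Walkℕ (suc m)) (Γ-path : IsPathℕ Γ)
           (Γ-start : nd Γ 0 ≡ hd G (ar F 0)) (Γ-end : nd Γ (suc m) ≡ hd G (ar F 0))
           (Γ-last : ar Γ m ≢ ar F 0) where

    M : ℕ
    M = suc m

    private
      Γ-% : ∀ {t} → t ≤ M → nd Γ t ≡ nd Γ (t % M)
      Γ-% {t} t≤M with m≤n⇒m<n∨m≡n t≤M
      ... | inj₁ t<M = cong (nd Γ) (sym (m<n⇒m%n≡m t<M))
      ... | inj₂ refl = trans Γ-end (trans (sym Γ-start) (cong (nd Γ) (sym (n%n≡0 M))))

    followsCycle : ∀ {i s} → i < ℓ → s < M → nd F (suc i) ≡ nd Γ s → ar F (suc i) ≡ ar Γ s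
    followsCycle {i} {s} i<ℓ s<M on-s with ar F (suc i) Fin.≟ ar Γ s
    ... | yes same = same
    ... | no  differ = ⊥-elim (omnitig z<s (s≤s i<ℓ) rest (suffix-path rest-len Γ Γ-path)
                         (trans (sym on-s) (sym (tl-ar F (s≤s i<ℓ))))
                         (trans (cong (nd Γ) rest-len) Γ-end)
                         (differ ∘ sym)
                         (Γ-last ∘ trans (cong (ar Γ) (sym (m∸n+n≡m (≤-pred s<M))))))
      where
      rest-len = cong suc (m∸n+n≡m (≤-pred s<M))
      rest = suffix (suc (m ∸ s)) s rest-len Γ

    windsAround : ∀ {i} → i < suc ℓ → nd F (suc i) ≡ nd Γ (i % M)
    windsAround {zero}  _       = trans (sym (hd-ar F z<s)) (sym Γ-start)
    windsAround {suc i} 1+i<1+ℓ = begin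
      nd F (suc (suc i))      ≡⟨ hd-ar F 1+i<1+ℓ ⟨
      hd G (ar F (suc i))     ≡⟨ cong (hd G) (followsCycle i<ℓ (m%n<n i M) (windsAround (m<n⇒m<1+n i<ℓ))) ⟩
      hd G (ar Γ (i % M))     ≡⟨ hd-ar Γ (m%n<n i M) ⟩
      nd Γ (suc (i % M))      ≡⟨ Γ-% (m%n<n i M) ⟩
      nd Γ (suc (i % M) % M)  ≡⟨ cong (nd Γ) (sym (suc-% i M)) ⟩
      nd Γ (suc i % M)        ∎
      where
      open ≡-Reasoning
      i<ℓ = ≤-pred 1+i<1+ℓ

    onCycle : ∀ {i} → i < suc ℓ → i < M → nd F (suc i) ≡ nd Γ i
    onCycle i<1+ℓ i<M = trans (windsAround i<1+ℓ) (cong (nd Γ) (m<n⇒m%n≡m i<M))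

    noDetour : ∀ {n x c} (S : Walkℕ (suc n)) → IsPathℕ S → x < ℓ → c < suc ℓ →
      nd S 0 ≡ nd F (suc x) → nd S (suc n) ≡ nd F (suc c) →
      ar S 0 ≢ ar F (suc x) → (∀ {a} → a < suc ℓ → ar S n ≢ ar F a) →
      (∀ {i} → 0 < i → i < suc n → nd S i ≢ nd F 1) → ⊥
    noDetour {n} {x} {c} S S-path x<ℓ c<1+ℓ S-start S-end S-first S-last S-avoids =
      [ returnsBehind , returnsAhead ]′ (≤-<-connex q x)
      where
      q = c % M
      q<M = m%n<n c M
      S-end′ : nd S (suc n) ≡ nd Γ q
      S-end′ = trans S-end (windsAround c<1+ℓ)

      returnsBehind : q ≤ x → ⊥
      returnsBehind q≤x = omnitig (s≤s q≤x) (s≤s x<ℓ) S S-path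
        (trans S-start (sym (tl-ar F (s≤s x<ℓ))))
        (trans S-end′ (trans (sym (onCycle q<1+ℓ q<M)) (sym (hd-ar F q<1+ℓ))))
        S-first (S-last q<1+ℓ)
        where q<1+ℓ = ≤-<-trans (m%n≤m c M) c<1+ℓ

      returnsAhead : x < q → ⊥
      returnsAhead x<q =
        let k , Q , Q-path , Q-start , Q-end , Q-first , Q-last =
              spliceIntoCycle Γ Γ-path x<q q<M S S-path (trans S-start x-on) S-end′
                (λ 0<i i<1+n eq → S-avoids 0<i i<1+n (trans eq (trans Γ-end (hd-ar F z<s))))
        in omnitig z<s (s≤s x<ℓ) Q Q-path
             (trans Q-start (trans (sym x-on) (sym (tl-ar F (s≤s x<ℓ)))))
             (trans Q-end Γ-end)
             (S-first ∘ trans (sym Q-first))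
             (Γ-last ∘ trans (sym Q-last))
        where x-on = onCycle (m<n⇒m<1+n x<ℓ) (<-trans x<q q<M)

    internalNodesAvoid : ∀ {k} (P : Walkℕ (suc k)) → IsPathℕ P → nd P 0 ≡ nd F (suc ℓ) →
      ∀ {c} → c < suc ℓ → nd P (suc k) ≡ nd F (suc c) → (∀ {a} → a < suc ℓ → ar P k ≢ ar F a) →
      ∀ {r} → 0 < r → r < suc k → ∀ {i} → i < suc ℓ → nd P r ≢ nd F (suc i)
    internalNodesAvoid {k} P P-path P-start {c} c<1+ℓ P-end P-last {r} 0<r r<1+k {i} i<1+ℓ on-i
      with greatestBelow onF? (suc k) r<1+k (i , i<1+ℓ , on-i)
      where
      OnF : ℕ → Set
      OnF t = ∃ λ x → x < suc ℓ × nd P t ≡ nd F (suc x)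
      onF? : Decidable OnF
      onF? t = anyUpTo? (λ x → nd P t Fin.≟ nd F (suc x)) (suc ℓ)
    ... | s , r≤s , s<1+k , (x , x<1+ℓ , on-x) , lastOnF =
      noDetour S (suffix-path S-len P P-path) x<ℓ c<1+ℓ on-x (trans (cong (nd P) S-len) P-end)
        (leaves (s≤s x<ℓ)) S-last S-avoids
      where
      s≤k = ≤-pred s<1+k
      0<s = <-≤-trans 0<r r≤s
      S-len = cong suc (m∸n+n≡m s≤k)
      S = suffix (suc (k ∸ s)) s S-len P

      x<ℓ : x < ℓ
      x<ℓ = ≤∧≢⇒< (≤-pred x<1+ℓ) λ { refl → notAtStart (P-path (<⇒≤ s<1+k) z≤n (trans on-x (sym P-start))) }
        where
        notAtStart : ¬ SameUpToEnds (suc k) s 0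
        notAtStart (inj₁ s≡0)               = <⇒≢ 0<s (sym s≡0)
        notAtStart (inj₂ (inj₁ (s≡0 , _)))  = <⇒≢ 0<s (sym s≡0)
        notAtStart (inj₂ (inj₂ (s≡1+k , _))) = <⇒≢ s<1+k s≡1+k

      leaves : ∀ {a} → a < suc ℓ → ar P s ≢ ar F a
      leaves {a} a<1+ℓ eq with m≤n⇒m<n∨m≡n s≤k
      ... | inj₁ s<k  = lastOnF (n<1+n s) (s≤s s<k)
                          (a , a<1+ℓ , trans (sym (hd-ar P s<1+k)) (trans (cong (hd G) eq) (hd-ar F a<1+ℓ)))
      ... | inj₂ refl = P-last a<1+ℓ eq

      S-last : ∀ {a} → a < suc ℓ → ar S (k ∸ s) ≢ ar F a
      S-last a<1+ℓ eq = P-last a<1+ℓ (trans (cong (ar P) (sym (m∸n+n≡m s≤k))) eq)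

      S-avoids : ∀ {i} → 0 < i → i < suc (k ∸ s) → nd S i ≢ nd F 1
      S-avoids {i} 0<i i<1+k-s eq =
        lastOnF (m<n+m s 0<i) (subst (i + s <_) S-len (+-monoˡ-< s i<1+k-s)) (0 , z<s , eq)

lemma29 : (G : Graph) → StronglyConnected G → IsCompressed G → ¬ IsClosedPath G →
    ∀ {ℓ} (f : Arc G) (W : Walk G ℓ) (p : hd G f ≡ start W) →
    IsOmnitig (cons f W p) → IsJoinArc G f →
    ∀ k (P : Walk G (suc k)) → IsPath P → start P ≡ end W →
    (∃ λ i → end P ≡ node W i) →
    (∀ j → arc P (fromℕ k) ≢ arc (cons f W p) j) →
    ∀ r → IsInternalIndex (suc k) r → ∀ i → node P r ≢ node W i
lemma29 G connected _ _ {ℓ} f W p omnitig join k P P-path P-start (c , P-end) P-last r (0<r , r<1+k) i on-i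
  with cycleThroughOtherInArc G connected join
... | m , Γ , Γ-path , Γ-start , Γ-end , Γ-last =
  internalNodesAvoid G F (toWalkℕ-omnitig G f fW omnitig) Γ Γ-path Γ-start Γ-end Γ-last
    P′ (toWalkℕ-path G (arc P Fin.zero) P P-path) (trans P-start (sym (toWalkℕ-end G f fW)))
    (toℕ<n c) (trans (toWalkℕ-end G (arc P Fin.zero) P) (trans P-end (sym (toWalkℕ-nd G f fW (Fin.suc c)))))
    P′-last 0<r r<1+k (toℕ<n i)
    (trans (toWalkℕ-nd G (arc P Fin.zero) P r) (trans on-i (sym (toWalkℕ-nd G f fW (Fin.suc i)))))
  where
  fW = cons f W p
  F  = toWalkℕ G f fW
  P′ = toWalkℕ G (arc P Fin.zero) P
  P′-last : ∀ {a} → a < suc ℓ → ar P′ k ≢ ar F a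
  P′-last a<1+ℓ eq = P-last (fromℕ< a<1+ℓ)
    (trans (sym (trans (cong (ar P′) (sym (toℕ-fromℕ k))) (toWalkℕ-ar G (arc P Fin.zero) P (fromℕ k))))
           (trans eq (lookupOr-< f (arc fW) a<1+ℓ)))
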